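{- There is no regular graph of odd degree $d\ge3$, girth $5$ and cyclic excess.
   Context: For an integer $d\ge 1$ define polynomials $G_{d,m}(x)$ by $G_{d,0}(x)=1$, $G_{d,1}(x)=x+1$, and $G_{d,m+1}(x)=xG_{d,m}(x)-(d-1)G_{d,m-1}(x)$ for $m\ge1$. Let $J_n$ be the $n\times n$ all-ones matrix. For a graph on $n\ge3$ vertices, a cycle matrix is the adjacency matrix $B$ of an $n$-cycle on the same vertex set (i.e., for some ordering $v_1,\dots,v_n$ of the vertices, $B_{ij}=1$ iff $v_i,v_j$ are cyclically consecutive, and $0$ otherwise); this cycle need not consist of edges of the graph. A graph $\Gamma$ of order $n$ with adjacency matrix $A$ is a graph of degree $d$, girth $g$ and cyclic excess if $\Gamma$ is $d$-regular with $d\ge3$, has odd girth $g\ge5$, and $G_{d,\lfloor g/2\rfloor}(A)=J_n-B$ for some cycle matrix $B$. (For $g=5$ this reads $A^2+A-(d-1)I_n=J_n-B$.) -}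

module Defs where

open import Data.Nat as ℕ using (ℕ; zero; suc; _≤_; _<_; NonZero)
open import Data.Nat.DivMod using (_mod_)
open import Data.Integer as ℤ using (ℤ; +_)
open import Data.Fin using (Fin; toℕ)
import Data.Fin as Fin
import Data.Bool
open import Data.Fin.Permutation using (Permutation′; _⟨$⟩ˡ_)
open import Data.Bool using (Bool; true; false; if_then_else_)
open import Data.List using (List; []; _∷_)
open import Data.Product using (Σ; ∃; _×_; _,_)
open import Data.Sum using (_⊎_)
open import Relation.Binary.PropositionalEquality using (_≡_; _≢_)
open import Relation.Nullary using (¬_)
open import Relation.Nullary.Decidable using (⌊_⌋)
open import Function.Definitions using (Injective)
open import Data.Fin.Properties using () renaming (_≟_ to _≟ᶠ_)

record Graph (n : ℕ) : Set where
  field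
    adj   : Fin n → Fin n → Bool
    sym   : ∀ x y → adj x y ≡ adj y x
    irrefl : ∀ x → adj x x ≡ false
open Graph public

sumFin : ∀ {A : Set} → (A → A → A) → A → (n : ℕ) → (Fin n → A) → A
sumFin _⊕_ e zero    f = e
sumFin _⊕_ e (suc n) f = f Fin.zero ⊕ sumFin _⊕_ e n (λ i → f (Fin.suc i))

degree : ∀ {n} → Graph n → Fin n → ℕ
degree {n} Γ x = sumFin ℕ._+_ 0 n (λ y → if adj Γ x y then 1 else 0)

Regular : ∀ {n} → Graph n → ℕ → Set
Regular Γ d = ∀ x → degree Γ x ≡ d

csucc : ∀ {k} .{{_ : NonZero k}} → Fin k → Fin k
csucc {k} i = suc (toℕ i) mod k

nz : ∀ {k} → 3 ≤ k → NonZero k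
nz (ℕ.s≤s _) = _

record Cycle {n} (Γ : Graph n) (k : ℕ) : Set where
  field
    3≤k  : 3 ≤ k
    vert : Fin k → Fin n
    inj  : Injective _≡_ _≡_ vert
    edges : ∀ (i : Fin k) → adj Γ (vert i) (vert (csucc {k} {{nz 3≤k}} i)) ≡ true
open Cycle public

Girth : ∀ {n} → Graph n → ℕ → Set
Girth Γ g = Cycle Γ g × (∀ k → k < g → ¬ Cycle Γ k)

Odd : ℕ → Set
Odd m = ∃ λ k → m ≡ suc (2 ℕ.* k)

Matrix : ℕ → Set
Matrix n = Fin n → Fin n → ℤ

idM : ∀ {n} → Matrix n
idM i j = if ⌊ i ≟ᶠ j ⌋ then + 1 else + 0

onesM : ∀ {n} → Matrix n
onesM _ _ = + 1

_+M_ : ∀ {n} → Matrix n → Matrix n → Matrix n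
(A +M B) i j = A i j ℤ.+ B i j

_-M_ : ∀ {n} → Matrix n → Matrix n → Matrix n
(A -M B) i j = A i j ℤ.- B i j

_*M_ : ∀ {n} → Matrix n → Matrix n → Matrix n
_*M_ {n} A B i j = sumFin ℤ._+_ (+ 0) n (λ k → A i k ℤ.* B k j)

scaleM : ∀ {n} → ℤ → Matrix n → Matrix n
scaleM c A i j = c ℤ.* A i j

adjM : ∀ {n} → Graph n → Matrix n
adjM Γ i j = if adj Γ i j then + 1 else + 0

-- polynomials over ℤ as coefficient lists, constant term first
Poly : Set
Poly = List ℤ

_+P_ : Poly → Poly → Poly
[] +P q = q
(a ∷ p) +P [] = a ∷ p
(a ∷ p) +P (b ∷ q) = (a ℤ.+ b) ∷ (p +P q)

scaleP : ℤ → Poly → Poly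
scaleP c [] = []
scaleP c (a ∷ p) = (c ℤ.* a) ∷ scaleP c p

xP : Poly → Poly
xP p = + 0 ∷ p

evalM : ∀ {n} → Poly → Matrix n → Matrix n
evalM [] A = λ _ _ → + 0
evalM (a ∷ p) A = scaleM a idM +M (A *M evalM p A)

G : ℕ → ℕ → Poly
G d 0 = + 1 ∷ []
G d 1 = + 1 ∷ + 1 ∷ []
G d (suc (suc m)) = xP (G d (suc m)) +P scaleP (ℤ.- (+ (d ℕ.∸ 1))) (G d m)

Consecutive : ∀ {n} .{{_ : NonZero n}} → Fin n → Fin n → Set
Consecutive i j = j ≡ csucc i ⊎ i ≡ csucc j

consecutive? : ∀ {n} .{{_ : NonZero n}} → Fin n → Fin n → Bool
consecutive? i j = ⌊ j ≟ᶠ csucc i ⌋ Data.Bool.∨ ⌊ i ≟ᶠ csucc j ⌋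

-- the cycle matrix of the ordering v_1,...,v_n given by the permutation σ
-- (σ maps positions to vertices; B_{xy} = 1 iff σ⁻¹ x, σ⁻¹ y are cyclically consecutive)
cycleMatrix : ∀ {n} .{{_ : NonZero n}} → Permutation′ n → Matrix n
cycleMatrix σ x y = if consecutive? (σ ⟨$⟩ˡ x) (σ ⟨$⟩ˡ y) then + 1 else + 0

record CyclicExcess {n} (Γ : Graph n) (d g : ℕ) : Set where
  field
    3≤n     : 3 ≤ n
    regular : Regular Γ d
    3≤d     : 3 ≤ d
    gOdd    : Odd g
    5≤g     : 5 ≤ g
    girth   : Girth Γ g
    σ       : Permutation′ n
    equation : ∀ x y →
      evalM (G d (g ℕ./ 2)) (adjM Γ) x y
        ≡ (onesM -M cycleMatrix {{nz 3≤n}} σ) x y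

-- Write A for the adjacency matrix and B for the cycle matrix, so that A² + A − (d − 1)I = J − B.
-- Since AJ = JA = dJ, B is a polynomial in A and J and commutes with A; applied to the all-ones vector
-- the equation gives n = d² + 3, which is divisible by 4 when d is odd. The cycle matrix then has the
-- simple eigenvalue −2, with eigenvector z = (1, −1, 1, −1, …) along the cycle, and a two-dimensional
-- kernel spanned by u₀ = (1, 0, −1, 0, …) and u₁ = (0, 1, 0, −1, …). A preserves both eigenspaces:
-- Az = θz, and on the kernel A acts by an integer matrix with entries a, b, c, e. The equation on
-- these vectors yields θ² + θ = d + 1, a² + bc + a = d − 1 and c(1 + a + e) = 0, while a parity
-- argument shows that a + e is even. Hence c = 0, and θ² + θ and a² + a ≥ 2 are pronic numbers two
-- apart, which is impossible.

module Submission where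

open import Defs hiding (sym)
open import Data.Nat as ℕ using (ℕ; zero; suc; NonZero; _≤_; s≤s; z≤n; _∸_; _%_; _/_)
import Data.Nat.Properties as ℕP
import Data.Nat.Tactic.RingSolver as ℕ-Solver
open import Data.Nat.DivMod
  using (_mod_; m≡m%n+[m/n]*n; m<n⇒m%n≡m; m%n<n; %-distribˡ-+; [m+n]%n≡m%n; [m+kn]%n≡m%n)
open import Data.Integer as ℤ using (ℤ; +_; -[1+_]; _+_; _*_; -_; _-_; 0ℤ; 1ℤ; -1ℤ)
import Data.Integer.Properties as ℤP
open import Data.Integer.Tactic.RingSolver using (solve-∀)
open import Data.Fin as Fin using (Fin; toℕ)
import Data.Fin.Properties as FinP
open import Data.Fin.Permutation using (Permutation′; _⟨$⟩ʳ_; _⟨$⟩ˡ_; inverseˡ; inverseʳ)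
open import Data.Vec.Functional using (Vector; removeAt)
open import Algebra.Properties.Semiring.Sum ℤP.+-*-semiring
  using (sum; sum-cong-≗; ∑-distrib-+; ∑-comm; ∑-permute; *-distribˡ-sum; *-distribʳ-sum;
         sum-remove; sum-replicate-zero)
open import Data.List using ([]; _∷_)
open import Data.Bool using (Bool; true; false; if_then_else_)
open import Data.Product using (_×_; _,_; ∃; proj₁; proj₂)
open import Data.Sum using ([_,_]′)
open import Data.Empty using (⊥-elim)
open import Function using (_∘_; id)
open import Relation.Nullary using (¬_; yes; no)
open import Relation.Binary.PropositionalEquality

-- Matrices acting on vectors

sumFin≡sum : ∀ n (f : Vector ℤ n) → sumFin _+_ (+ 0) n f ≡ sum f
sumFin≡sum zero    f = refl
sumFin≡sum (suc n) f = cong (λ s → f Fin.zero + s) (sumFin≡sum n (f ∘ Fin.suc))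

sum-vanishing-off : ∀ {n} (f : Vector ℤ n) x → (∀ y → y ≢ x → f y ≡ + 0) → sum f ≡ f x
sum-vanishing-off {suc n} f x f≡0 = begin
  sum f                    ≡⟨ sum-remove {i = x} f ⟩
  f x + sum (removeAt f x) ≡⟨ cong (λ s → f x + s) removed≡0 ⟩
  f x + + 0                ≡⟨ ℤP.+-identityʳ (f x) ⟩
  f x                      ∎
  where
  open ≡-Reasoning
  removed≡0 : sum (removeAt f x) ≡ + 0
  removed≡0 = trans (sum-cong-≗ {y = λ _ → + 0} λ j → f≡0 _ (FinP.punchInᵢ≢i x j)) (sum-replicate-zero n)

sum-ones : ∀ n → sum {n} (λ _ → 1ℤ) ≡ + n
sum-ones zero    = refl
sum-ones (suc n) = cong (λ s → 1ℤ + s) (sum-ones n)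

module _ {n : ℕ} where

  infixr 7 _*ᵥ_ _·ᵥ_
  infixl 6 _+ᵥ_

  _*ᵥ_ : Matrix n → Vector ℤ n → Vector ℤ n
  (M *ᵥ f) x = sum λ y → M x y * f y

  _+ᵥ_ : Vector ℤ n → Vector ℤ n → Vector ℤ n
  (f +ᵥ g) x = f x + g x

  _·ᵥ_ : ℤ → Vector ℤ n → Vector ℤ n
  (c ·ᵥ f) x = c * f x

  *ᵥ-cong : ∀ M {f g : Vector ℤ n} → f ≗ g → M *ᵥ f ≗ M *ᵥ g
  *ᵥ-cong M f≗g x = sum-cong-≗ λ y → cong (M x y *_) (f≗g y)

  *ᵥ-distrib-+ᵥ : ∀ M f g → M *ᵥ (f +ᵥ g) ≗ M *ᵥ f +ᵥ M *ᵥ g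
  *ᵥ-distrib-+ᵥ M f g x =
    trans (sum-cong-≗ λ y → ℤP.*-distribˡ-+ (M x y) (f y) (g y))
          (∑-distrib-+ (λ y → M x y * f y) (λ y → M x y * g y))

  *ᵥ-·ᵥ : ∀ M c f → M *ᵥ (c ·ᵥ f) ≗ c ·ᵥ (M *ᵥ f)
  *ᵥ-·ᵥ M c f x =
    trans (sum-cong-≗ λ y → swap (M x y) c (f y)) (sym (*-distribˡ-sum c (λ y → M x y * f y)))
    where
    swap : ∀ m c v → m * (c * v) ≡ c * (m * v)
    swap = solve-∀

  *ᵥ-const : ∀ M c → M *ᵥ (λ _ → c) ≗ λ x → sum (M x) * c
  *ᵥ-const M c x = sym (*-distribʳ-sum c (M x))

  +M-*ᵥ : ∀ M N f → (M +M N) *ᵥ f ≗ M *ᵥ f +ᵥ N *ᵥ f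
  +M-*ᵥ M N f x =
    trans (sum-cong-≗ λ y → ℤP.*-distribʳ-+ (f y) (M x y) (N x y))
          (∑-distrib-+ (λ y → M x y * f y) (λ y → N x y * f y))

  *M-*ᵥ : ∀ M N f → (M *M N) *ᵥ f ≗ M *ᵥ (N *ᵥ f)
  *M-*ᵥ M N f x = begin
    sum (λ y → sumFin _+_ (+ 0) n (λ k → M x k * N k y) * f y)
      ≡⟨ sum-cong-≗ (λ y → cong (_* f y) (sumFin≡sum n (λ k → M x k * N k y))) ⟩
    sum (λ y → sum (λ k → M x k * N k y) * f y)
      ≡⟨ sum-cong-≗ (λ y → *-distribʳ-sum (f y) (λ k → M x k * N k y)) ⟩
    sum (λ y → sum (λ k → M x k * N k y * f y))
      ≡⟨ ∑-comm (λ y k → M x k * N k y * f y) ⟩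
    sum (λ k → sum (λ y → M x k * N k y * f y))
      ≡⟨ sum-cong-≗ (λ k → trans (sum-cong-≗ λ y → ℤP.*-assoc (M x k) (N k y) (f y))
                                 (sym (*-distribˡ-sum (M x k) (λ y → N k y * f y)))) ⟩
    sum (λ k → M x k * (N *ᵥ f) k) ∎
    where open ≡-Reasoning

  idM-off : ∀ (x y : Fin n) → y ≢ x → idM x y ≡ + 0
  idM-off x y y≢x with x FinP.≟ y
  ... | yes x≡y = ⊥-elim (y≢x (sym x≡y))
  ... | no  _   = refl

  idM-diag : ∀ (x : Fin n) → idM x x ≡ + 1
  idM-diag x with x FinP.≟ x
  ... | yes _   = refl
  ... | no  x≢x = ⊥-elim (x≢x refl)

  idM-*ᵥ : ∀ f → idM *ᵥ f ≗ f
  idM-*ᵥ f x = begin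
    sum (λ y → idM x y * f y) ≡⟨ sum-vanishing-off _ x (λ y y≢x → cong (_* f y) (idM-off x y y≢x)) ⟩
    idM x x * f x             ≡⟨ cong (_* f x) (idM-diag x) ⟩
    + 1 * f x                 ≡⟨ ℤP.*-identityˡ (f x) ⟩
    f x                       ∎
    where open ≡-Reasoning

  scaleM-*ᵥ : ∀ c M f → scaleM c M *ᵥ f ≗ c ·ᵥ (M *ᵥ f)
  scaleM-*ᵥ c M f x =
    trans (sum-cong-≗ λ y → ℤP.*-assoc c (M x y) (f y))
          (sym (*-distribˡ-sum c (λ y → M x y * f y)))

  evalM-[]-*ᵥ : ∀ M f → evalM [] M *ᵥ f ≗ λ _ → + 0
  evalM-[]-*ᵥ M f x = trans (sum-cong-≗ λ y → ℤP.*-zeroˡ (f y)) (sum-replicate-zero n)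

  evalM-∷-*ᵥ : ∀ a p M f → evalM (a ∷ p) M *ᵥ f ≗ a ·ᵥ f +ᵥ M *ᵥ (evalM p M *ᵥ f)
  evalM-∷-*ᵥ a p M f x = begin
    (evalM (a ∷ p) M *ᵥ f) x
      ≡⟨ +M-*ᵥ (scaleM a idM) (M *M evalM p M) f x ⟩
    (scaleM a idM *ᵥ f) x + ((M *M evalM p M) *ᵥ f) x
      ≡⟨ cong₂ _+_ (trans (scaleM-*ᵥ a idM f x) (cong (a *_) (idM-*ᵥ f x)))
                   (*M-*ᵥ M (evalM p M) f x) ⟩
    a * f x + (M *ᵥ (evalM p M *ᵥ f)) x ∎
    where open ≡-Reasoning

  evalM-G₂-*ᵥ : ∀ d M f → evalM (G d 2) M *ᵥ f ≗ M *ᵥ M *ᵥ f +ᵥ M *ᵥ f +ᵥ - + (d ∸ 1) ·ᵥ f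
  evalM-G₂-*ᵥ d M f x = begin
    (evalM (G d 2) M *ᵥ f) x
      ≡⟨ evalM-∷-*ᵥ c₀ (+ 1 ∷ + 1 ∷ []) M f x ⟩
    c₀ * f x + (M *ᵥ (evalM (+ 1 ∷ + 1 ∷ []) M *ᵥ f)) x
      ≡⟨ cong (λ s → c₀ * f x + s) (*ᵥ-cong M linear x) ⟩
    c₀ * f x + (M *ᵥ (f +ᵥ M *ᵥ f)) x
      ≡⟨ cong (λ s → c₀ * f x + s) (*ᵥ-distrib-+ᵥ M f (M *ᵥ f) x) ⟩
    c₀ * f x + ((M *ᵥ f) x + (M *ᵥ M *ᵥ f) x)
      ≡⟨ rearrange (+ (d ∸ 1)) (f x) ((M *ᵥ f) x) ((M *ᵥ M *ᵥ f) x) ⟩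
    (M *ᵥ M *ᵥ f) x + (M *ᵥ f) x + - + (d ∸ 1) * f x ∎
    where
    open ≡-Reasoning
    c₀ = + 0 + - + (d ∸ 1) * + 1
    linear : evalM (+ 1 ∷ + 1 ∷ []) M *ᵥ f ≗ f +ᵥ M *ᵥ f
    linear y = begin
      (evalM (+ 1 ∷ + 1 ∷ []) M *ᵥ f) y        ≡⟨ evalM-∷-*ᵥ (+ 1) (+ 1 ∷ []) M f y ⟩
      + 1 * f y + (M *ᵥ (evalM (+ 1 ∷ []) M *ᵥ f)) y
        ≡⟨ cong₂ _+_ (ℤP.*-identityˡ (f y)) (*ᵥ-cong M constant y) ⟩
      f y + (M *ᵥ f) y ∎
      where
      constant : evalM (+ 1 ∷ []) M *ᵥ f ≗ f
      constant z = begin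
        (evalM (+ 1 ∷ []) M *ᵥ f) z                   ≡⟨ evalM-∷-*ᵥ (+ 1) [] M f z ⟩
        + 1 * f z + (M *ᵥ (evalM [] M *ᵥ f)) z
          ≡⟨ cong (λ s → + 1 * f z + s) (*ᵥ-cong M (evalM-[]-*ᵥ M f) z) ⟩
        + 1 * f z + (M *ᵥ (λ _ → + 0)) z
          ≡⟨ cong (λ s → + 1 * f z + s) (*ᵥ-const M (+ 0) z) ⟩
        + 1 * f z + sum (M z) * + 0                     ≡⟨ drop-zero (f z) (sum (M z)) ⟩
        f z                                             ∎
        where
        drop-zero : ∀ v s → + 1 * v + s * + 0 ≡ v
        drop-zero = solve-∀
    rearrange : ∀ κ v w w₂ → (+ 0 + - κ * + 1) * v + (w + w₂) ≡ w₂ + w + - κ * v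
    rearrange = solve-∀

-- Regular graphs

sum-indicator : ∀ n (b : Fin n → Bool) →
  sum (λ y → if b y then + 1 else + 0) ≡ + sumFin ℕ._+_ 0 n (λ y → if b y then 1 else 0)
sum-indicator zero    b = refl
sum-indicator (suc n) b =
  trans (cong₂ _+_ (indicator-+ (b Fin.zero)) (sum-indicator n (b ∘ Fin.suc)))
        (sym (ℤP.pos-+ (if b Fin.zero then 1 else 0) _))
  where
  indicator-+ : ∀ c → (if c then + 1 else + 0) ≡ + (if c then 1 else 0)
  indicator-+ true  = refl
  indicator-+ false = refl

module RegularGraph {n d} (Γ : Graph n) (regular : Regular Γ d) where

  A : Matrix n
  A = adjM Γ

  A-sym : ∀ x y → A x y ≡ A y x
  A-sym x y = cong (λ b → if b then + 1 else + 0) (Graph.sym Γ x y)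

  row-sum : ∀ x → sum (A x) ≡ + d
  row-sum x = trans (sum-indicator n (adj Γ x)) (cong +_ (regular x))

  A-*ᵥ-const : ∀ c → A *ᵥ (λ _ → c) ≗ λ _ → + d * c
  A-*ᵥ-const c x = trans (*ᵥ-const A c x) (cong (_* c) (row-sum x))

  sum-A-*ᵥ : ∀ g → sum (A *ᵥ g) ≡ + d * sum g
  sum-A-*ᵥ g = begin
    sum (λ x → sum (λ y → A x y * g y)) ≡⟨ ∑-comm (λ x y → A x y * g y) ⟩
    sum (λ y → sum (λ x → A x y * g y)) ≡⟨ sum-cong-≗ column ⟩
    sum (λ y → + d * g y)               ≡⟨ *-distribˡ-sum (+ d) g ⟨
    + d * sum g                         ∎
    where
    open ≡-Reasoning
    column : ∀ y → sum (λ x → A x y * g y) ≡ + d * g y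
    column y = begin
      sum (λ x → A x y * g y) ≡⟨ *-distribʳ-sum (g y) (λ x → A x y) ⟨
      sum (λ x → A x y) * g y ≡⟨ cong (_* g y) (trans (sum-cong-≗ λ x → A-sym x y) (row-sum y)) ⟩
      + d * g y               ∎

  A-*ᵥ-affine : ∀ {f g h : Vector ℤ n} c α β → (∀ y → f y ≡ c + (α * g y + β * h y)) →
                A *ᵥ f ≗ λ x → + d * c + (α * (A *ᵥ g) x + β * (A *ᵥ h) x)
  A-*ᵥ-affine {f} {g} {h} c α β f≗ x = begin
    (A *ᵥ f) x
      ≡⟨ *ᵥ-cong A f≗ x ⟩
    (A *ᵥ ((λ _ → c) +ᵥ (α ·ᵥ g +ᵥ β ·ᵥ h))) x
      ≡⟨ *ᵥ-distrib-+ᵥ A (λ _ → c) _ x ⟩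
    (A *ᵥ (λ _ → c)) x + (A *ᵥ (α ·ᵥ g +ᵥ β ·ᵥ h)) x
      ≡⟨ cong₂ _+_ (A-*ᵥ-const c x) (*ᵥ-distrib-+ᵥ A (α ·ᵥ g) (β ·ᵥ h) x) ⟩
    + d * c + ((A *ᵥ (α ·ᵥ g)) x + (A *ᵥ (β ·ᵥ h)) x)
      ≡⟨ cong (λ s → + d * c + s) (cong₂ _+_ (*ᵥ-·ᵥ A α g x) (*ᵥ-·ᵥ A β h x)) ⟩
    + d * c + (α * (A *ᵥ g) x + β * (A *ᵥ h) x) ∎
    where open ≡-Reasoning

-- Integer arithmetic

double≡0⇒≡0 : ∀ x → x + x ≡ + 0 → x ≡ + 0
double≡0⇒≡0 x x+x≡0 = ℤP.*-cancelˡ-≡ (+ 2) x (+ 0) (trans (double x) x+x≡0)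
  where
  double : ∀ x → + 2 * x ≡ x + x
  double = solve-∀

1+double≢0 : ∀ x → + 1 + (x + x) ≢ + 0
1+double≢0 (+ zero)  ()
1+double≢0 (+ suc m) ()
1+double≢0 -[1+ m ]  ()

pronic : ∀ x → ∃ λ m → x * x + x ≡ + (m ℕ.* suc m)
pronic (+ m) = m , (begin
  + m * + m + + m      ≡⟨ cong (_+ + m) (ℤP.pos-* m m) ⟨
  + (m ℕ.* m) + + m    ≡⟨ ℤP.pos-+ (m ℕ.* m) m ⟨
  + (m ℕ.* m ℕ.+ m)    ≡⟨ cong +_ (ℕP.+-comm (m ℕ.* m) m) ⟩
  + (m ℕ.+ m ℕ.* m)    ≡⟨ cong +_ (ℕP.*-suc m m) ⟨
  + (m ℕ.* suc m)      ∎)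
  where open ≡-Reasoning
pronic -[1+ m ] = m , (begin
  -[1+ m ] * -[1+ m ] + -[1+ m ]      ≡⟨ reflect (+ m) ⟩
  + m * (1ℤ + + m)                   ≡⟨ cong (+ m *_) (ℤP.pos-+ 1 m) ⟨
  + m * + suc m                      ≡⟨ ℤP.pos-* m (suc m) ⟨
  + (m ℕ.* suc m)                    ∎)
  where
  open ≡-Reasoning
  reflect : ∀ m → - (1ℤ + m) * - (1ℤ + m) + - (1ℤ + m) ≡ m * (1ℤ + m)
  reflect = solve-∀

pronic-gapℕ : ∀ p q → p ℕ.* suc p ≡ q ℕ.* suc q ℕ.+ 2 → q ≡ 0
pronic-gapℕ p zero    _  = refl
pronic-gapℕ p (suc q) eq with p ℕ.≤? suc q
... | yes p≤q = ⊥-elim (ℕP.<-irrefl refl (begin-strict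
  p ℕ.* suc p         ≤⟨ ℕP.*-mono-≤ p≤q (s≤s p≤q) ⟩
  X                   <⟨ ℕP.m<m+n X (s≤s z≤n) ⟩
  X ℕ.+ 2             ≡⟨ eq ⟨
  p ℕ.* suc p         ∎))
  where
  open ℕP.≤-Reasoning
  X = suc q ℕ.* suc (suc q)
... | no p≰q = ⊥-elim (ℕP.<-irrefl refl (begin-strict
  X ℕ.+ 2                               <⟨ ℕP.+-monoʳ-< X (ℕP.*-monoʳ-< 2 (s≤s (s≤s z≤n))) ⟩
  X ℕ.+ 2 ℕ.* suc (suc q)                ≡⟨ next-pronic q ⟨
  suc (suc q) ℕ.* suc (suc (suc q))      ≤⟨ ℕP.*-mono-≤ q<p (s≤s q<p) ⟩
  p ℕ.* suc p                           ≡⟨ eq ⟩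
  X ℕ.+ 2                               ∎))
  where
  open ℕP.≤-Reasoning
  X = suc q ℕ.* suc (suc q)
  q<p = ℕP.≰⇒> p≰q
  next-pronic : ∀ q →
    suc (suc q) ℕ.* suc (suc (suc q)) ≡ suc q ℕ.* suc (suc q) ℕ.+ 2 ℕ.* suc (suc q)
  next-pronic = ℕ-Solver.solve-∀

pronic-gap : ∀ x y → x * x + x ≡ (y * y + y) + + 2 → y * y + y ≡ + 0
pronic-gap x y eq with pronic x | pronic y
... | p , x-pronic | q , y-pronic =
  trans y-pronic (cong (λ q → + (q ℕ.* suc q)) (pronic-gapℕ p q (ℤP.+-injective (begin
    + (p ℕ.* suc p)           ≡⟨ x-pronic ⟨
    x * x + x                 ≡⟨ eq ⟩
    (y * y + y) + + 2          ≡⟨ cong (_+ + 2) y-pronic ⟩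
    + (q ℕ.* suc q) + + 2      ≡⟨ ℤP.pos-+ (q ℕ.* suc q) 2 ⟨
    + (q ℕ.* suc q ℕ.+ 2)      ∎))))
  where open ≡-Reasoning

odd-square+3 : ∀ t → suc (2 ℕ.* t) ℕ.* suc (2 ℕ.* t) ℕ.+ 3 ≡ (t ℕ.* t ℕ.+ t ℕ.+ 1) ℕ.* 4
odd-square+3 = ℕ-Solver.solve-∀

-- Periodic sequences

Periodic : ℕ → (ℕ → ℤ) → Set
Periodic p F = ∀ k → F (p ℕ.+ k) ≡ F k

periodic-* : ∀ {p F} → Periodic p F → ∀ m → Periodic (m ℕ.* p) F
periodic-* F-per zero    k = refl
periodic-* {p} {F} F-per (suc m) k =
  trans (cong F (ℕP.+-assoc p (m ℕ.* p) k)) (trans (F-per (m ℕ.* p ℕ.+ k)) (periodic-* F-per m k))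

periodic-% : ∀ {p F} .{{_ : NonZero p}} → Periodic p F → ∀ k → F (k % p) ≡ F k
periodic-% {p} {F} F-per k = begin
  F (k % p)                   ≡⟨ periodic-* F-per (k / p) (k % p) ⟨
  F (k / p ℕ.* p ℕ.+ k % p)   ≡⟨ cong F (ℕP.+-comm (k / p ℕ.* p) (k % p)) ⟩
  F (k % p ℕ.+ k / p ℕ.* p)   ≡⟨ cong F (m≡m%n+[m/n]*n k p) ⟨
  F k                         ∎
  where open ≡-Reasoning

period4 : ℤ → ℤ → ℤ → ℤ → ℕ → ℤ
period4 a b c e 0 = a
period4 a b c e 1 = b
period4 a b c e 2 = c
period4 a b c e 3 = e
period4 a b c e (suc (suc (suc (suc k)))) = period4 a b c e k

period4-periodic : ∀ a b c e → Periodic 4 (period4 a b c e)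
period4-periodic a b c e k = refl

mod4-induction : (P : ℕ → Set) → P 0 → P 1 → P 2 → P 3 → (∀ k → P k → P (4 ℕ.+ k)) → ∀ k → P k
mod4-induction P p₀ p₁ p₂ p₃ step 0 = p₀
mod4-induction P p₀ p₁ p₂ p₃ step 1 = p₁
mod4-induction P p₀ p₁ p₂ p₃ step 2 = p₂
mod4-induction P p₀ p₁ p₂ p₃ step 3 = p₃
mod4-induction P p₀ p₁ p₂ p₃ step (suc (suc (suc (suc k)))) = step k (mod4-induction P p₀ p₁ p₂ p₃ step k)

-- cos (kπ), cos (kπ/2), sin (kπ/2) and the indicators of k ≡ 0 mod 2, k ≡ 2 mod 4, k ≡ 3 mod 4
alternating cosQuarter sinQuarter evenIndicator indicator2mod4 indicator3mod4 : ℕ → ℤ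
alternating    = period4 1ℤ -1ℤ 1ℤ -1ℤ
cosQuarter     = period4 1ℤ 0ℤ -1ℤ 0ℤ
sinQuarter     = period4 0ℤ 1ℤ 0ℤ -1ℤ
evenIndicator  = period4 1ℤ 0ℤ 1ℤ 0ℤ
indicator2mod4 = period4 0ℤ 0ℤ 1ℤ 0ℤ
indicator3mod4 = period4 0ℤ 0ℤ 0ℤ 1ℤ

Recurrence : ℤ → (ℕ → ℤ) → Set
Recurrence μ W = ∀ k → W (2 ℕ.+ k) + W k ≡ μ * W (suc k)

alternating-recurrence : Recurrence (- + 2) alternating
alternating-recurrence = mod4-induction _ refl refl refl refl (λ _ p → p)

cosQuarter-recurrence : Recurrence (+ 0) cosQuarter
cosQuarter-recurrence = mod4-induction _ refl refl refl refl (λ _ p → p)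

sinQuarter-recurrence : Recurrence (+ 0) sinQuarter
sinQuarter-recurrence = mod4-induction _ refl refl refl refl (λ _ p → p)

cosQuarter-+2 : ∀ k → cosQuarter (2 ℕ.+ k) ≡ - cosQuarter k
cosQuarter-+2 = mod4-induction _ refl refl refl refl (λ _ p → p)

sinQuarter-+2 : ∀ k → sinQuarter (2 ℕ.+ k) ≡ - sinQuarter k
sinQuarter-+2 = mod4-induction _ refl refl refl refl (λ _ p → p)

alternating-+2 : ∀ k → alternating (2 ℕ.+ k) ≡ alternating k
alternating-+2 = mod4-induction _ refl refl refl refl (λ _ p → p)

alternating-suc : ∀ k → alternating (suc k) ≡ - alternating k
alternating-suc = mod4-induction _ refl refl refl refl (λ _ p → p)

alternating² : ∀ k → alternating k * alternating k ≡ 1ℤ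
alternating² = mod4-induction _ refl refl refl refl (λ _ p → p)

alternating-via-even : ∀ k → alternating k ≡ -1ℤ + (+ 2 * evenIndicator k + + 0 * evenIndicator k)
alternating-via-even = mod4-induction _ refl refl refl refl (λ _ p → p)

cosQuarter-via-even : ∀ k → cosQuarter k ≡ + 0 + (1ℤ * evenIndicator k + - + 2 * indicator2mod4 k)
cosQuarter-via-even = mod4-induction _ refl refl refl refl (λ _ p → p)

sinQuarter-via-even : ∀ k → sinQuarter k ≡ 1ℤ + (-1ℤ * evenIndicator k + - + 2 * indicator3mod4 k)
sinQuarter-via-even = mod4-induction _ refl refl refl refl (λ _ p → p)

alternating-independent : ∀ {α s} → (∀ k → α * alternating k ≡ s) → α ≡ + 0
alternating-independent {α} {s} const =
  double≡0⇒≡0 α (trans (sum-of-values α) (trans (cong₂ _-_ (const 0) (const 1)) (ℤP.+-inverseʳ s)))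
  where
  sum-of-values : ∀ α → α + α ≡ α * 1ℤ - α * -1ℤ
  sum-of-values = solve-∀

quarter-independent : ∀ {α β s} → (∀ k → α * cosQuarter k + β * sinQuarter k ≡ s) → α ≡ + 0 × β ≡ + 0
quarter-independent {α} {β} {s} const = α≡0 , β≡0
  where
  α≡0 : α ≡ + 0
  α≡0 = double≡0⇒≡0 α (trans (at-0-and-2 α β) (trans (cong₂ _-_ (const 0) (const 2)) (ℤP.+-inverseʳ s)))
    where
    at-0-and-2 : ∀ α β → α + α ≡ (α * 1ℤ + β * 0ℤ) - (α * -1ℤ + β * 0ℤ)
    at-0-and-2 = solve-∀
  β≡0 : β ≡ + 0
  β≡0 = begin
    β                                       ≡⟨ at-1-and-0 α β ⟩
    (α * 0ℤ + β * 1ℤ) - (α * 1ℤ + β * 0ℤ) + α ≡⟨ cong₂ (λ u v → u - v + α) (const 1) (const 0) ⟩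
    s - s + α                               ≡⟨ cong₂ _+_ (ℤP.+-inverseʳ s) α≡0 ⟩
    + 0                                     ∎
    where
    open ≡-Reasoning
    at-1-and-0 : ∀ α β → β ≡ (α * 0ℤ + β * 1ℤ) - (α * 1ℤ + β * 0ℤ) + α
    at-1-and-0 = solve-∀

arithmetic-progression : ∀ (Y : ℕ → ℤ) → (∀ k → Y (2 ℕ.+ k) ≡ + 2 * Y (suc k) - Y k) →
                         ∀ k → Y k ≡ Y 0 + + k * (Y 1 - Y 0)
arithmetic-progression Y step k = proj₁ (consecutive k)
  where
  δ = Y 1 - Y 0
  consecutive : ∀ k → Y k ≡ Y 0 + + k * δ × Y (suc k) ≡ Y 0 + + suc k * δ
  consecutive zero    = initial₀ (Y 0) (Y 1) , initial₁ (Y 0) (Y 1)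
    where
    initial₀ : ∀ y₀ y₁ → y₀ ≡ y₀ + + 0 * (y₁ - y₀)
    initial₀ = solve-∀
    initial₁ : ∀ y₀ y₁ → y₁ ≡ y₀ + 1ℤ * (y₁ - y₀)
    initial₁ = solve-∀
  consecutive (suc k) with consecutive k
  ... | Yk , Yk+1 = Yk+1 , trans (step k) (trans (cong₂ (λ u v → + 2 * u - v) Yk+1 Yk) (extend (Y 0) δ (+ k)))
    where
    extend : ∀ y₀ δ k → + 2 * (y₀ + (1ℤ + k) * δ) - (y₀ + k * δ) ≡ y₀ + (+ 2 + k) * δ
    extend = solve-∀

quarter-solution : ∀ {W} → Recurrence (+ 0) W → ∀ k → W k ≡ W 0 * cosQuarter k + W 1 * sinQuarter k
quarter-solution {W} rec k = proj₁ (consecutive k)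
  where
  Solution : ℕ → Set
  Solution k = W k ≡ W 0 * cosQuarter k + W 1 * sinQuarter k
  consecutive : ∀ k → Solution k × Solution (suc k)
  consecutive zero = initial₀ (W 0) (W 1) , initial₁ (W 0) (W 1)
    where
    initial₀ : ∀ w₀ w₁ → w₀ ≡ w₀ * 1ℤ + w₁ * 0ℤ
    initial₀ = solve-∀
    initial₁ : ∀ w₀ w₁ → w₁ ≡ w₀ * 0ℤ + w₁ * 1ℤ
    initial₁ = solve-∀
  consecutive (suc k) with consecutive k
  ... | Wk , Wk+1 = Wk+1 , (begin
    W (2 ℕ.+ k)                                                ≡⟨ isolate (W (2 ℕ.+ k)) (W k) ⟩
    (W (2 ℕ.+ k) + W k) - W k                                  ≡⟨ cong₂ _-_ (rec k) Wk ⟩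
    + 0 * W (suc k) - (W 0 * cosQuarter k + W 1 * sinQuarter k)
      ≡⟨ negate (W (suc k)) (W 0) (W 1) (cosQuarter k) (sinQuarter k) ⟩
    W 0 * - cosQuarter k + W 1 * - sinQuarter k
      ≡⟨ cong₂ (λ c s → W 0 * c + W 1 * s) (cosQuarter-+2 k) (sinQuarter-+2 k) ⟨
    W 0 * cosQuarter (2 ℕ.+ k) + W 1 * sinQuarter (2 ℕ.+ k)     ∎)
    where
    open ≡-Reasoning
    isolate : ∀ x y → x ≡ (x + y) - y
    isolate = solve-∀
    negate : ∀ z w₀ w₁ c s → + 0 * z - (w₀ * c + w₁ * s) ≡ w₀ * - c + w₁ * - s
    negate = solve-∀

-- Y = alternating · W has vanishing second differences, so it is an arithmetic progression,
-- and a periodic arithmetic progression is constant.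
alternating-solution : ∀ {p W} .{{_ : NonZero p}} → Recurrence (- + 2) W →
                       Periodic p W → Periodic p alternating → ∀ k → W k ≡ W 0 * alternating k
alternating-solution {p} {W} rec W-per alt-per k = begin
  W k                                     ≡⟨ unalternate (alternating k) (W k) (alternating² k) ⟩
  alternating k * Y k                     ≡⟨ cong (alternating k *_) (arithmetic-progression Y Y-step k) ⟩
  alternating k * (Y 0 + + k * δ)          ≡⟨ cong (λ δ → alternating k * (Y 0 + + k * δ)) δ≡0 ⟩
  alternating k * (Y 0 + + k * + 0)        ≡⟨ collapse (alternating k) (W 0) (+ k) ⟩
  W 0 * alternating k                     ∎
  where
  open ≡-Reasoning
  Y : ℕ → ℤ
  Y k = alternating k * W k
  δ = Y 1 - Y 0
  Y-step : ∀ k → Y (2 ℕ.+ k) ≡ + 2 * Y (suc k) - Y k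
  Y-step k = begin
    alternating (2 ℕ.+ k) * W (2 ℕ.+ k)            ≡⟨ cong (_* W (2 ℕ.+ k)) (alternating-+2 k) ⟩
    alternating k * W (2 ℕ.+ k)                    ≡⟨ isolate (alternating k) (W (2 ℕ.+ k)) (W k) ⟩
    alternating k * ((W (2 ℕ.+ k) + W k) - W k)    ≡⟨ cong (λ u → alternating k * (u - W k)) (rec k) ⟩
    alternating k * (- + 2 * W (suc k) - W k)      ≡⟨ regroup (alternating k) (W (suc k)) (W k) ⟩
    + 2 * (- alternating k * W (suc k)) - Y k      ≡⟨ cong (λ a → + 2 * (a * W (suc k)) - Y k) (alternating-suc k) ⟨
    + 2 * Y (suc k) - Y k                          ∎
    where
    isolate : ∀ a x y → a * x ≡ a * ((x + y) - y)
    isolate = solve-∀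
    regroup : ∀ a x y → a * (- + 2 * x - y) ≡ + 2 * (- a * x) - a * y
    regroup = solve-∀
  Y-periodic : Y p ≡ Y 0
  Y-periodic = subst (λ q → Y q ≡ Y 0) (ℕP.+-identityʳ p) (cong₂ _*_ (alt-per 0) (W-per 0))
  δ≡0 : δ ≡ + 0
  δ≡0 = ℤP.*-cancelˡ-≡ (+ p) δ (+ 0) (begin
    + p * δ               ≡⟨ isolate (Y 0) (+ p * δ) ⟩
    (Y 0 + + p * δ) - Y 0  ≡⟨ cong (_- Y 0) (trans (sym (arithmetic-progression Y Y-step p)) Y-periodic) ⟩
    Y 0 - Y 0             ≡⟨ ℤP.+-inverseʳ (Y 0) ⟩
    + 0                   ≡⟨ ℤP.*-zeroʳ (+ p) ⟨
    + p * + 0             ∎)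
    where
    isolate : ∀ y x → x ≡ (y + x) - y
    isolate = solve-∀
  unalternate : ∀ a w → a * a ≡ 1ℤ → w ≡ a * (a * w)
  unalternate a w a²≡1 =
    sym (trans (sym (ℤP.*-assoc a a w)) (trans (cong (_* w) a²≡1) (ℤP.*-identityˡ w)))
  collapse : ∀ a w k → a * (1ℤ * w + k * + 0) ≡ w * a
  collapse = solve-∀

-- The cycle matrix

%-cancelˡ-+ : ∀ a {m m′} n .{{_ : NonZero n}} → (a ℕ.+ m) % n ≡ (a ℕ.+ m′) % n → m % n ≡ m′ % n
%-cancelˡ-+ a {m} {m′} (suc n-1) eq = begin
  m % n                                        ≡⟨ shift m ⟩
  (a ℕ.* n-1 ℕ.+ (a ℕ.+ m)) % n                  ≡⟨ %-distribˡ-+ (a ℕ.* n-1) (a ℕ.+ m) n ⟩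
  ((a ℕ.* n-1) % n ℕ.+ (a ℕ.+ m) % n) % n        ≡⟨ cong (λ r → ((a ℕ.* n-1) % n ℕ.+ r) % n) eq ⟩
  ((a ℕ.* n-1) % n ℕ.+ (a ℕ.+ m′) % n) % n       ≡⟨ %-distribˡ-+ (a ℕ.* n-1) (a ℕ.+ m′) n ⟨
  (a ℕ.* n-1 ℕ.+ (a ℕ.+ m′)) % n                 ≡⟨ shift m′ ⟨
  m′ % n                                       ∎
  where
  open ≡-Reasoning
  n = suc n-1
  -- adding a·(n−1) completes a to a multiple of n
  shift : ∀ k → k % n ≡ (a ℕ.* n-1 ℕ.+ (a ℕ.+ k)) % n
  shift k = trans (sym ([m+kn]%n≡m%n k a n)) (cong (_% n) (regroup a n-1 k))
    where
    regroup : ∀ a n-1 k → k ℕ.+ a ℕ.* suc n-1 ≡ a ℕ.* n-1 ℕ.+ (a ℕ.+ k)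
    regroup = ℕ-Solver.solve-∀

module CycleMatrix {n} (3≤n : 3 ≤ n) (σ : Permutation′ n) where

  instance
    n≢0 : NonZero n
    n≢0 = nz 3≤n

  B : Matrix n
  B = cycleMatrix σ

  toℕ-mod : ∀ k → toℕ (k mod n) ≡ k % n
  toℕ-mod k = FinP.toℕ-fromℕ< (m%n<n k n)

  mod-toℕ : ∀ i → toℕ i mod n ≡ i
  mod-toℕ i = FinP.toℕ-injective (trans (toℕ-mod (toℕ i)) (m<n⇒m%n≡m (FinP.toℕ<n i)))

  csucc-mod : ∀ k → csucc (k mod n) ≡ suc k mod n
  csucc-mod k = FinP.toℕ-injective (begin
    toℕ (csucc (k mod n))              ≡⟨ toℕ-mod (suc (toℕ (k mod n))) ⟩
    suc (toℕ (k mod n)) % n            ≡⟨ cong (λ r → suc r % n) (toℕ-mod k) ⟩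
    suc (k % n) % n                    ≡⟨ [m+kn]%n≡m%n (suc (k % n)) (k / n) n ⟨
    (suc (k % n) ℕ.+ k / n ℕ.* n) % n   ≡⟨ cong (λ m → suc m % n) (m≡m%n+[m/n]*n k n) ⟨
    suc k % n                          ≡⟨ toℕ-mod (suc k) ⟨
    toℕ (suc k mod n)                  ∎)
    where open ≡-Reasoning

  csucc-injective : ∀ {i j : Fin n} → csucc i ≡ csucc j → i ≡ j
  csucc-injective {i} {j} eq = FinP.toℕ-injective (begin
    toℕ i      ≡⟨ m<n⇒m%n≡m (FinP.toℕ<n i) ⟨
    toℕ i % n  ≡⟨ %-cancelˡ-+ 1 n (trans (sym (toℕ-mod _)) (trans (cong toℕ eq) (toℕ-mod _))) ⟩
    toℕ j % n  ≡⟨ m<n⇒m%n≡m (FinP.toℕ<n j) ⟩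
    toℕ j      ∎)
    where open ≡-Reasoning

  csucc²≢id : ∀ (i : Fin n) → csucc (csucc i) ≢ i
  csucc²≢id i eq = ℕP.1+n≢0 (begin
    2          ≡⟨ m<n⇒m%n≡m 3≤n ⟨
    2 % n      ≡⟨ %-cancelˡ-+ k n shifted ⟩
    0 % n      ≡⟨ m<n⇒m%n≡m (ℕP.<-trans (s≤s z≤n) 3≤n) ⟩
    0          ∎)
    where
    open ≡-Reasoning
    k = toℕ i
    two-steps : (2 ℕ.+ k) mod n ≡ k mod n
    two-steps = begin
      (2 ℕ.+ k) mod n         ≡⟨ csucc-mod (suc k) ⟨
      csucc (suc k mod n)     ≡⟨ cong csucc (csucc-mod k) ⟨
      csucc (csucc (k mod n)) ≡⟨ cong (λ j → csucc (csucc j)) (mod-toℕ i) ⟩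
      csucc (csucc i)         ≡⟨ trans eq (sym (mod-toℕ i)) ⟩
      k mod n                 ∎
    shifted : (k ℕ.+ 2) % n ≡ (k ℕ.+ 0) % n
    shifted = begin
      (k ℕ.+ 2) % n           ≡⟨ cong (_% n) (ℕP.+-comm k 2) ⟩
      (2 ℕ.+ k) % n           ≡⟨ toℕ-mod (2 ℕ.+ k) ⟨
      toℕ ((2 ℕ.+ k) mod n)   ≡⟨ cong toℕ two-steps ⟩
      toℕ (k mod n)           ≡⟨ toℕ-mod k ⟩
      k % n                   ≡⟨ cong (_% n) (ℕP.+-identityʳ k) ⟨
      (k ℕ.+ 0) % n           ∎

  consecutive-indicator : ∀ {p q : Fin n} → csucc q ≡ p → ∀ i →
                          (if consecutive? p i then + 1 else + 0) ≡ idM (csucc p) i + idM q i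
  consecutive-indicator {q = q} refl i with i FinP.≟ csucc (csucc q) | csucc q FinP.≟ csucc i
  ... | yes refl | _ = cong₂ _+_ (sym (idM-diag (csucc (csucc q)))) (sym (idM-off q _ (csucc²≢id q)))
  ... | no i≢ | yes q→i rewrite csucc-injective q→i = sym (cong₂ _+_ (idM-off _ i i≢) (idM-diag i))
  ... | no i≢ | no q↛i =
    sym (cong₂ _+_ (idM-off _ i i≢) (idM-off q i λ i≡q → q↛i (cong csucc (sym i≡q))))

  B-*ᵥ : ∀ f {p q : Fin n} → csucc q ≡ p → (B *ᵥ f) (σ ⟨$⟩ʳ p) ≡ f (σ ⟨$⟩ʳ csucc p) + f (σ ⟨$⟩ʳ q)
  B-*ᵥ f {p} {q} q→p = begin
    sum (λ y → B (σ ⟨$⟩ʳ p) y * f y)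
      ≡⟨ ∑-permute (λ y → B (σ ⟨$⟩ʳ p) y * f y) σ ⟩
    sum (λ i → B (σ ⟨$⟩ʳ p) (σ ⟨$⟩ʳ i) * g i)
      ≡⟨ sum-cong-≗ (λ i → cong (_* g i) (entry i)) ⟩
    sum (λ i → (idM (csucc p) i + idM q i) * g i)
      ≡⟨ sum-cong-≗ (λ i → ℤP.*-distribʳ-+ (g i) (idM (csucc p) i) (idM q i)) ⟩
    sum (λ i → idM (csucc p) i * g i + idM q i * g i)
      ≡⟨ ∑-distrib-+ (λ i → idM (csucc p) i * g i) (λ i → idM q i * g i) ⟩
    (idM *ᵥ g) (csucc p) + (idM *ᵥ g) q
      ≡⟨ cong₂ _+_ (idM-*ᵥ g (csucc p)) (idM-*ᵥ g q) ⟩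
    g (csucc p) + g q ∎
    where
    open ≡-Reasoning
    g : Vector ℤ n
    g i = f (σ ⟨$⟩ʳ i)
    entry : ∀ i → B (σ ⟨$⟩ʳ p) (σ ⟨$⟩ʳ i) ≡ idM (csucc p) i + idM q i
    entry i = trans (cong₂ (λ a b → if consecutive? a b then + 1 else + 0) (inverseˡ σ) (inverseˡ σ))
                    (consecutive-indicator q→p i)

  vtx : ℕ → Fin n
  vtx k = σ ⟨$⟩ʳ (k mod n)

  position : Fin n → ℕ
  position y = toℕ (σ ⟨$⟩ˡ y)

  vtx-position : ∀ y → vtx (position y) ≡ y
  vtx-position y = trans (cong (σ ⟨$⟩ʳ_) (mod-toℕ (σ ⟨$⟩ˡ y))) (inverseʳ σ)

  vtx-+n : ∀ k → vtx (n ℕ.+ k) ≡ vtx k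
  vtx-+n k = cong (σ ⟨$⟩ʳ_) (FinP.toℕ-injective (begin
    toℕ ((n ℕ.+ k) mod n)  ≡⟨ toℕ-mod (n ℕ.+ k) ⟩
    (n ℕ.+ k) % n          ≡⟨ cong (_% n) (ℕP.+-comm n k) ⟩
    (k ℕ.+ n) % n          ≡⟨ [m+n]%n≡m%n k n ⟩
    k % n                  ≡⟨ toℕ-mod k ⟨
    toℕ (k mod n)          ∎))
    where open ≡-Reasoning

  vtx-surjective : ∀ x → ∃ λ k → vtx (suc k) ≡ x
  vtx-surjective x = position x ℕ.+ ℕ.pred n , (begin
    vtx (suc (position x ℕ.+ ℕ.pred n))  ≡⟨ cong vtx (ℕP.+-suc (position x) (ℕ.pred n)) ⟨
    vtx (position x ℕ.+ suc (ℕ.pred n))  ≡⟨ cong (λ m → vtx (position x ℕ.+ m)) (ℕP.suc-pred n) ⟩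
    vtx (position x ℕ.+ n)               ≡⟨ cong vtx (ℕP.+-comm (position x) n) ⟩
    vtx (n ℕ.+ position x)               ≡⟨ vtx-+n (position x) ⟩
    vtx (position x)                     ≡⟨ vtx-position x ⟩
    x                                    ∎)
    where open ≡-Reasoning

  B-*ᵥ-vtx : ∀ f k → (B *ᵥ f) (vtx (suc k)) ≡ f (vtx (2 ℕ.+ k)) + f (vtx k)
  B-*ᵥ-vtx f k =
    trans (B-*ᵥ f (csucc-mod k)) (cong (λ i → f (σ ⟨$⟩ʳ i) + f (vtx k)) (csucc-mod (suc k)))

  along : (ℕ → ℤ) → Vector ℤ n
  along F y = F (position y)

  around : Vector ℤ n → ℕ → ℤ
  around w k = w (vtx k)

  along-vtx : ∀ {F} → Periodic n F → ∀ k → along F (vtx k) ≡ F k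
  along-vtx {F} F-per k =
    trans (cong (F ∘ toℕ) (inverseˡ σ)) (trans (cong F (toℕ-mod k)) (periodic-% F-per k))

  around-periodic : ∀ w → Periodic n (around w)
  around-periodic w k = cong w (vtx-+n k)

  along-around : ∀ w → along (around w) ≗ w
  along-around w y = cong w (vtx-position y)

  B-along : ∀ {μ F} → Recurrence μ F → Periodic n F → B *ᵥ along F ≗ μ ·ᵥ along F
  B-along {μ} {F} rec F-per x with vtx-surjective x
  ... | k , refl = begin
    (B *ᵥ along F) (vtx (suc k))                    ≡⟨ B-*ᵥ-vtx (along F) k ⟩
    along F (vtx (2 ℕ.+ k)) + along F (vtx k)
      ≡⟨ cong₂ _+_ (along-vtx F-per (2 ℕ.+ k)) (along-vtx F-per k) ⟩
    F (2 ℕ.+ k) + F k                               ≡⟨ rec k ⟩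
    μ * F (suc k)                                   ≡⟨ cong (μ *_) (along-vtx F-per (suc k)) ⟨
    μ * along F (vtx (suc k))                       ∎
    where open ≡-Reasoning

  eigenvector-recurrence : ∀ {μ w} → B *ᵥ w ≗ μ ·ᵥ w → Recurrence μ (around w)
  eigenvector-recurrence {w = w} eig k = trans (sym (B-*ᵥ-vtx w k)) (eig (vtx (suc k)))

  B-kernel : ∀ {w} → B *ᵥ w ≗ + 0 ·ᵥ w →
             w ≗ w (vtx 0) ·ᵥ along cosQuarter +ᵥ w (vtx 1) ·ᵥ along sinQuarter
  B-kernel {w} eig y =
    trans (sym (along-around w y))
          (quarter-solution {around w} (eigenvector-recurrence {+ 0} eig) (position y))

  B-eigenvector⁻² : Periodic n alternating →
                    ∀ {w} → B *ᵥ w ≗ - + 2 ·ᵥ w → w ≗ w (vtx 0) ·ᵥ along alternating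
  B-eigenvector⁻² alt-per {w} eig y =
    trans (sym (along-around w y))
          (alternating-solution {W = around w} (eigenvector-recurrence { - + 2} eig)
                                (around-periodic w) alt-per (position y))

-- Graphs of girth 5 and cyclic excess

module Girth5CyclicExcess {n d} {Γ : Graph n} (ce : CyclicExcess Γ d 5) where

  open CyclicExcess ce
  open RegularGraph Γ regular
  open CycleMatrix 3≤n σ

  κ : ℤ
  κ = + (d ∸ 1)

  Q : Vector ℤ n → Vector ℤ n
  Q f = A *ᵥ A *ᵥ f +ᵥ A *ᵥ f +ᵥ - κ ·ᵥ f

  Q+B : ∀ f x → Q f x + (B *ᵥ f) x ≡ sum f
  Q+B f x = begin
    Q f x + (B *ᵥ f) x
      ≡⟨ cong (_+ (B *ᵥ f) x) (evalM-G₂-*ᵥ d A f x) ⟨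
    (evalM (G d 2) A *ᵥ f) x + (B *ᵥ f) x
      ≡⟨ cong (_+ (B *ᵥ f) x) (sum-cong-≗ λ y → cong (_* f y) (equation x y)) ⟩
    sum (λ y → (1ℤ - B x y) * f y) + sum (λ y → B x y * f y)
      ≡⟨ ∑-distrib-+ (λ y → (1ℤ - B x y) * f y) (λ y → B x y * f y) ⟨
    sum (λ y → (1ℤ - B x y) * f y + B x y * f y)
      ≡⟨ sum-cong-≗ (λ y → cancel (B x y) (f y)) ⟩
    sum f ∎
    where
    open ≡-Reasoning
    cancel : ∀ b v → (1ℤ - b) * v + b * v ≡ v
    cancel = solve-∀

  Q-*ᵥ : ∀ g → A *ᵥ Q g ≗ Q (A *ᵥ g)
  Q-*ᵥ g x = begin
    (A *ᵥ Q g) x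
      ≡⟨ *ᵥ-distrib-+ᵥ A (A *ᵥ A *ᵥ g +ᵥ A *ᵥ g) (- κ ·ᵥ g) x ⟩
    (A *ᵥ (A *ᵥ A *ᵥ g +ᵥ A *ᵥ g)) x + (A *ᵥ (- κ ·ᵥ g)) x
      ≡⟨ cong₂ _+_ (*ᵥ-distrib-+ᵥ A (A *ᵥ A *ᵥ g) (A *ᵥ g) x) (*ᵥ-·ᵥ A (- κ) g x) ⟩
    Q (A *ᵥ g) x ∎
    where open ≡-Reasoning

  Q-B-eigenvector : ∀ {μ g} → B *ᵥ g ≗ μ ·ᵥ g → Q g ≗ (λ _ → sum g) +ᵥ - μ ·ᵥ g
  Q-B-eigenvector {μ} {g} eig y = begin
    Q g y                               ≡⟨ isolate (Q g y) ((B *ᵥ g) y) ⟩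
    (Q g y + (B *ᵥ g) y) - (B *ᵥ g) y   ≡⟨ cong₂ _-_ (Q+B g y) (eig y) ⟩
    sum g - μ * g y                     ≡⟨ cong (λ s → sum g + s) (ℤP.neg-distribˡ-* μ (g y)) ⟩
    sum g + - μ * g y                   ∎
    where
    open ≡-Reasoning
    isolate : ∀ q b → q ≡ (q + b) - b
    isolate = solve-∀

  A-preserves-B-eigenvectors : ∀ {μ g} → B *ᵥ g ≗ μ ·ᵥ g → B *ᵥ A *ᵥ g ≗ μ ·ᵥ (A *ᵥ g)
  A-preserves-B-eigenvectors {μ} {g} eig x = begin
    (B *ᵥ A *ᵥ g) x
      ≡⟨ isolate (Q (A *ᵥ g) x) ((B *ᵥ A *ᵥ g) x) ⟩
    (Q (A *ᵥ g) x + (B *ᵥ A *ᵥ g) x) - Q (A *ᵥ g) x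
      ≡⟨ cong₂ _-_ (Q+B (A *ᵥ g) x) (sym (Q-*ᵥ g x)) ⟩
    sum (A *ᵥ g) - (A *ᵥ Q g) x
      ≡⟨ cong₂ _-_ (sum-A-*ᵥ g) (*ᵥ-cong A (Q-B-eigenvector {μ} eig) x) ⟩
    + d * sum g - (A *ᵥ ((λ _ → sum g) +ᵥ - μ ·ᵥ g)) x
      ≡⟨ cong (λ s → + d * sum g - s) (*ᵥ-distrib-+ᵥ A (λ _ → sum g) (- μ ·ᵥ g) x) ⟩
    + d * sum g - ((A *ᵥ (λ _ → sum g)) x + (A *ᵥ - μ ·ᵥ g) x)
      ≡⟨ cong₂ (λ s t → + d * sum g - (s + t)) (A-*ᵥ-const (sum g) x) (*ᵥ-·ᵥ A (- μ) g x) ⟩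
    + d * sum g - (+ d * sum g + - μ * (A *ᵥ g) x)
      ≡⟨ simplify (+ d * sum g) μ ((A *ᵥ g) x) ⟩
    μ * (A *ᵥ g) x ∎
    where
    open ≡-Reasoning
    isolate : ∀ q b → b ≡ (q + b) - q
    isolate = solve-∀
    simplify : ∀ s μ v → s - (s + - μ * v) ≡ μ * v
    simplify = solve-∀

  order : n ≡ d ℕ.* d ℕ.+ 3
  order = ℤP.+-injective (begin
    + n
      ≡⟨ sum-ones n ⟨
    sum {n} (λ _ → 1ℤ)
      ≡⟨ Q+B (λ _ → 1ℤ) (vtx 1) ⟨
    Q (λ _ → 1ℤ) (vtx 1) + (B *ᵥ (λ _ → 1ℤ)) (vtx 1)
      ≡⟨ cong₂ _+_ Q-ones (B-*ᵥ-vtx (λ _ → 1ℤ) 0) ⟩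
    (+ d * (+ d * 1ℤ) + + d * 1ℤ + - κ * 1ℤ) + (1ℤ + 1ℤ)
      ≡⟨ cong (λ D → (D * (D * 1ℤ) + D * 1ℤ + - κ * 1ℤ) + (1ℤ + 1ℤ)) d≡1+κ ⟩
    ((1ℤ + κ) * ((1ℤ + κ) * 1ℤ) + (1ℤ + κ) * 1ℤ + - κ * 1ℤ) + (1ℤ + 1ℤ)
      ≡⟨ simplify κ ⟩
    (1ℤ + κ) * (1ℤ + κ) + + 3
      ≡⟨ cong (λ D → D * D + + 3) d≡1+κ ⟨
    + d * + d + + 3
      ≡⟨ cong (_+ + 3) (ℤP.pos-* d d) ⟨
    + (d ℕ.* d) + + 3
      ≡⟨ ℤP.pos-+ (d ℕ.* d) 3 ⟨
    + (d ℕ.* d ℕ.+ 3) ∎)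
    where
    open ≡-Reasoning
    d≡1+κ : + d ≡ 1ℤ + κ
    d≡1+κ = cong +_ (sym (ℕP.m+[n∸m]≡n (ℕP.≤-trans (s≤s z≤n) 3≤d)))
    Q-ones : Q (λ _ → 1ℤ) (vtx 1) ≡ + d * (+ d * 1ℤ) + + d * 1ℤ + - κ * 1ℤ
    Q-ones = cong₂ (λ s t → s + t + - κ * 1ℤ)
                   (trans (*ᵥ-cong A (A-*ᵥ-const 1ℤ) (vtx 1)) (A-*ᵥ-const (+ d * 1ℤ) (vtx 1)))
                   (A-*ᵥ-const 1ℤ (vtx 1))
    simplify : ∀ κ → ((1ℤ + κ) * ((1ℤ + κ) * 1ℤ) + (1ℤ + κ) * 1ℤ + - κ * 1ℤ) + (1ℤ + 1ℤ)
                     ≡ (1ℤ + κ) * (1ℤ + κ) + + 3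
    simplify = solve-∀

  Q-A-eigenvector : ∀ {θ u} → A *ᵥ u ≗ θ ·ᵥ u → Q u ≗ (θ * θ + θ - κ) ·ᵥ u
  Q-A-eigenvector {θ} {u} eig y = begin
    (A *ᵥ A *ᵥ u) y + (A *ᵥ u) y + - κ * u y
      ≡⟨ cong₂ (λ s t → s + t + - κ * u y) (trans (*ᵥ-cong A eig y) (*ᵥ-·ᵥ A θ u y)) (eig y) ⟩
    θ * (A *ᵥ u) y + θ * u y + - κ * u y
      ≡⟨ cong (λ s → θ * s + θ * u y + - κ * u y) (eig y) ⟩
    θ * (θ * u y) + θ * u y + - κ * u y
      ≡⟨ collect θ κ (u y) ⟩
    (θ * θ + θ - κ) * u y ∎
    where
    open ≡-Reasoning
    collect : ∀ θ κ v → θ * (θ * v) + θ * v + - κ * v ≡ (θ * θ + θ - κ) * v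
    collect = solve-∀

  Q-A-invariant-plane : ∀ {a b c e u v} → A *ᵥ u ≗ a ·ᵥ u +ᵥ c ·ᵥ v → A *ᵥ v ≗ b ·ᵥ u +ᵥ e ·ᵥ v →
                        Q u ≗ (a * a + c * b + a - κ) ·ᵥ u +ᵥ (c * (1ℤ + a + e)) ·ᵥ v
  Q-A-invariant-plane {a} {b} {c} {e} {u} {v} Au Av y = begin
    (A *ᵥ A *ᵥ u) y + (A *ᵥ u) y + - κ * u y
      ≡⟨ cong₂ (λ s t → s + t + - κ * u y) AAu (Au y) ⟩
    (a * (a * u y + c * v y) + c * (b * u y + e * v y)) + (a * u y + c * v y) + - κ * u y
      ≡⟨ collect a b c e κ (u y) (v y) ⟩
    (a * a + c * b + a - κ) * u y + c * (1ℤ + a + e) * v y ∎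
    where
    open ≡-Reasoning
    AAu : (A *ᵥ A *ᵥ u) y ≡ a * (a * u y + c * v y) + c * (b * u y + e * v y)
    AAu = begin
      (A *ᵥ A *ᵥ u) y                             ≡⟨ *ᵥ-cong A Au y ⟩
      (A *ᵥ (a ·ᵥ u +ᵥ c ·ᵥ v)) y                 ≡⟨ *ᵥ-distrib-+ᵥ A (a ·ᵥ u) (c ·ᵥ v) y ⟩
      (A *ᵥ a ·ᵥ u) y + (A *ᵥ c ·ᵥ v) y            ≡⟨ cong₂ _+_ (*ᵥ-·ᵥ A a u y) (*ᵥ-·ᵥ A c v y) ⟩
      a * (A *ᵥ u) y + c * (A *ᵥ v) y              ≡⟨ cong₂ (λ s t → a * s + c * t) (Au y) (Av y) ⟩
      a * (a * u y + c * v y) + c * (b * u y + e * v y) ∎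
    collect : ∀ a b c e κ u v → (a * (a * u + c * v) + c * (b * u + e * v)) + (a * u + c * v) + - κ * u
                                ≡ (a * a + c * b + a - κ) * u + c * (1ℤ + a + e) * v
    collect = solve-∀

  module FourDividesOrder (m : ℕ) (n≡m*4 : n ≡ m ℕ.* 4) where

    period4-periodic-n : ∀ a b c e → Periodic n (period4 a b c e)
    period4-periodic-n a b c e =
      subst (λ p → Periodic p (period4 a b c e)) (sym n≡m*4) (periodic-* (period4-periodic a b c e) m)

    z u₀ u₁ h r₂ r₃ : Vector ℤ n
    z  = along alternating
    u₀ = along cosQuarter
    u₁ = along sinQuarter
    h  = along evenIndicator
    r₂ = along indicator2mod4
    r₃ = along indicator3mod4

    x₀ x₁ : Fin n
    x₀ = vtx 0
    x₁ = vtx 1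

    θ a b c e : ℤ
    θ = (A *ᵥ z) x₀
    a = (A *ᵥ u₀) x₀
    c = (A *ᵥ u₀) x₁
    b = (A *ᵥ u₁) x₀
    e = (A *ᵥ u₁) x₁

    z-vtx : ∀ k → z (vtx k) ≡ alternating k
    z-vtx = along-vtx (period4-periodic-n 1ℤ -1ℤ 1ℤ -1ℤ)

    u₀-vtx : ∀ k → u₀ (vtx k) ≡ cosQuarter k
    u₀-vtx = along-vtx (period4-periodic-n 1ℤ 0ℤ -1ℤ 0ℤ)

    u₁-vtx : ∀ k → u₁ (vtx k) ≡ sinQuarter k
    u₁-vtx = along-vtx (period4-periodic-n 0ℤ 1ℤ 0ℤ -1ℤ)

    B-z : B *ᵥ z ≗ - + 2 ·ᵥ z
    B-z = B-along { - + 2} alternating-recurrence (period4-periodic-n _ _ _ _)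

    B-u₀ : B *ᵥ u₀ ≗ + 0 ·ᵥ u₀
    B-u₀ = B-along {+ 0} cosQuarter-recurrence (period4-periodic-n _ _ _ _)

    B-u₁ : B *ᵥ u₁ ≗ + 0 ·ᵥ u₁
    B-u₁ = B-along {+ 0} sinQuarter-recurrence (period4-periodic-n _ _ _ _)

    A-z : A *ᵥ z ≗ θ ·ᵥ z
    A-z = B-eigenvector⁻² (period4-periodic-n _ _ _ _) (A-preserves-B-eigenvectors { - + 2} B-z)

    A-u₀ : A *ᵥ u₀ ≗ a ·ᵥ u₀ +ᵥ c ·ᵥ u₁
    A-u₀ = B-kernel (A-preserves-B-eigenvectors {+ 0} B-u₀)

    A-u₁ : A *ᵥ u₁ ≗ b ·ᵥ u₀ +ᵥ e ·ᵥ u₁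
    A-u₁ = B-kernel (A-preserves-B-eigenvectors {+ 0} B-u₁)

    θ-equation : θ * θ + θ ≡ κ + + 2
    θ-equation = begin
      θ * θ + θ                         ≡⟨ split θ κ ⟩
      (θ * θ + θ - κ + - + 2) + (κ + + 2) ≡⟨ cong (_+ (κ + + 2)) coefficient≡0 ⟩
      + 0 + (κ + + 2)                   ≡⟨ ℤP.+-identityˡ (κ + + 2) ⟩
      κ + + 2                           ∎
      where
      open ≡-Reasoning
      split : ∀ θ κ → θ * θ + θ ≡ (θ * θ + θ - κ + - + 2) + (κ + + 2)
      split = solve-∀
      coefficient≡0 : θ * θ + θ - κ + - + 2 ≡ + 0
      coefficient≡0 = alternating-independent λ k → begin
        (θ * θ + θ - κ + - + 2) * alternating k      ≡⟨ cong ((θ * θ + θ - κ + - + 2) *_) (z-vtx k) ⟨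
        (θ * θ + θ - κ + - + 2) * z (vtx k)          ≡⟨ ℤP.*-distribʳ-+ (z (vtx k)) (θ * θ + θ - κ) (- + 2) ⟩
        (θ * θ + θ - κ) * z (vtx k) + - + 2 * z (vtx k)
          ≡⟨ cong₂ _+_ (Q-A-eigenvector {θ} A-z (vtx k)) (B-z (vtx k)) ⟨
        Q z (vtx k) + (B *ᵥ z) (vtx k)               ≡⟨ Q+B z (vtx k) ⟩
        sum z                                       ∎

    plane-coefficients : a * a + c * b + a - κ ≡ + 0 × c * (1ℤ + a + e) ≡ + 0
    plane-coefficients = quarter-independent λ k → begin
      X * cosQuarter k + Y * sinQuarter k
        ≡⟨ cong₂ (λ s t → X * s + Y * t) (u₀-vtx k) (u₁-vtx k) ⟨
      X * u₀ (vtx k) + Y * u₁ (vtx k)  ≡⟨ Q-A-invariant-plane {a} {b} {c} {e} A-u₀ A-u₁ (vtx k) ⟨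
      Q u₀ (vtx k)                     ≡⟨ ℤP.+-identityʳ (Q u₀ (vtx k)) ⟨
      Q u₀ (vtx k) + + 0
        ≡⟨ cong (λ s → Q u₀ (vtx k) + s) (trans (B-u₀ (vtx k)) (ℤP.*-zeroˡ (u₀ (vtx k)))) ⟨
      Q u₀ (vtx k) + (B *ᵥ u₀) (vtx k) ≡⟨ Q+B u₀ (vtx k) ⟩
      sum u₀                           ∎
      where
      open ≡-Reasoning
      X = a * a + c * b + a - κ
      Y = c * (1ℤ + a + e)

    -- Modulo 2, u₀ ≡ h and u₁ ≡ 1 − h for the indicator h of even positions, so a + e ≡ (Ah)(x₀) + d − (Ah)(x₁);
    -- and z = 2h − 1 with Az = θz forces (Ah)(x₀) + (Ah)(x₁) = d.
    trace-odd : 1ℤ + a + e ≢ + 0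
    trace-odd trace≡0 = 1+double≢0 X (begin
      1ℤ + (X + X)                           ≡⟨ regroup (+ d) (Ah x₀) (Ah x₁) (Ar₂ x₀) (Ar₃ x₁) ⟩
      (1ℤ + a′ + e′) + (Ah x₀ + Ah x₁ - + d)   ≡⟨ cong₂ (λ s t → 1ℤ + s + t + (Ah x₀ + Ah x₁ - + d)) a≡ e≡ ⟨
      (1ℤ + a + e) + (Ah x₀ + Ah x₁ - + d)     ≡⟨ cong₂ _+_ trace≡0 balance ⟩
      + 0                                    ∎)
      where
      open ≡-Reasoning
      Ah Ar₂ Ar₃ : Vector ℤ n
      Ah  = A *ᵥ h
      Ar₂ = A *ᵥ r₂
      Ar₃ = A *ᵥ r₃
      X  = Ah x₀ - Ar₂ x₀ - Ar₃ x₁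
      a′ = + d * + 0 + (1ℤ * Ah x₀ + - + 2 * Ar₂ x₀)
      e′ = + d * 1ℤ + (-1ℤ * Ah x₁ + - + 2 * Ar₃ x₁)
      a≡ : a ≡ a′
      a≡ = A-*ᵥ-affine (+ 0) 1ℤ (- + 2) (λ y → cosQuarter-via-even (position y)) x₀
      e≡ : e ≡ e′
      e≡ = A-*ᵥ-affine 1ℤ -1ℤ (- + 2) (λ y → sinQuarter-via-even (position y)) x₁
      Az≡ : ∀ y → (A *ᵥ z) y ≡ + d * -1ℤ + (+ 2 * Ah y + + 0 * Ah y)
      Az≡ = A-*ᵥ-affine {h = h} -1ℤ (+ 2) (+ 0) (λ y → alternating-via-even (position y))
      balance : Ah x₀ + Ah x₁ - + d ≡ + 0
      balance = double≡0⇒≡0 _ (begin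
        (Ah x₀ + Ah x₁ - + d) + (Ah x₀ + Ah x₁ - + d)
          ≡⟨ regroup-z (+ d) (Ah x₀) (Ah x₁) ⟩
        (+ d * -1ℤ + (+ 2 * Ah x₀ + + 0 * Ah x₀)) + (+ d * -1ℤ + (+ 2 * Ah x₁ + + 0 * Ah x₁))
          ≡⟨ cong₂ _+_ (Az≡ x₀) (Az≡ x₁) ⟨
        θ + (A *ᵥ z) x₁
          ≡⟨ cong (λ s → θ + s) (trans (A-z x₁) (cong (θ *_) (z-vtx 1))) ⟩
        θ + θ * -1ℤ
          ≡⟨ opposite θ ⟩
        + 0 ∎)
        where
        regroup-z : ∀ D h₀ h₁ → (h₀ + h₁ - D) + (h₀ + h₁ - D)
                                ≡ (D * -1ℤ + (+ 2 * h₀ + + 0 * h₀)) + (D * -1ℤ + (+ 2 * h₁ + + 0 * h₁))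
        regroup-z = solve-∀
        opposite : ∀ θ → θ + θ * -1ℤ ≡ + 0
        opposite = solve-∀
      regroup : ∀ D h₀ h₁ r₂ r₃ →
        1ℤ + ((h₀ - r₂ - r₃) + (h₀ - r₂ - r₃))
          ≡ (1ℤ + (D * + 0 + (1ℤ * h₀ + - + 2 * r₂)) + (D * 1ℤ + (-1ℤ * h₁ + - + 2 * r₃))) + (h₀ + h₁ - D)
      regroup = solve-∀

    c≡0 : c ≡ + 0
    c≡0 = [ id , ⊥-elim ∘ trace-odd ]′ (ℤP.i*j≡0⇒i≡0∨j≡0 c (proj₂ plane-coefficients))

    a-equation : a * a + a ≡ κ
    a-equation = begin
      a * a + a                         ≡⟨ split a b c κ ⟩
      (a * a + c * b + a - κ) + κ - c * b
        ≡⟨ cong₂ (λ s t → s + κ - t * b) (proj₁ plane-coefficients) c≡0 ⟩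
      + 0 + κ - + 0 * b                 ≡⟨ simplify κ b ⟩
      κ                                 ∎
      where
      open ≡-Reasoning
      split : ∀ a b c κ → a * a + a ≡ (a * a + c * b + a - κ) + κ - c * b
      split = solve-∀
      simplify : ∀ κ b → + 0 + κ - + 0 * b ≡ κ
      simplify = solve-∀

theorem4 : ∀ (n d : ℕ) (Γ : Graph n) → Odd d → 3 ≤ d → ¬ CyclicExcess Γ d 5
theorem4 n d Γ (t , d≡1+2t) 3≤d ce = ℕP.n≮0 (subst (2 ≤_) (ℤP.+-injective κ≡0) (ℕP.∸-monoˡ-≤ 1 3≤d))
  where
  open Girth5CyclicExcess ce
  open FourDividesOrder (t ℕ.* t ℕ.+ t ℕ.+ 1)
         (trans order (trans (cong (λ d → d ℕ.* d ℕ.+ 3) d≡1+2t) (odd-square+3 t)))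
  κ≡0 : κ ≡ + 0
  κ≡0 = trans (sym a-equation) (pronic-gap θ a (trans θ-equation (cong (_+ + 2) (sym a-equation))))
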